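{- Let $\mathcal{M}$ be a uniformly dense matroid of rank $r$ with $n$ elements, and let $1\le j\le n$. Let $(x_1,\dots,x_j)$ be a sequence of $j$ distinct elements of $\mathcal{M}$ chosen uniformly at random among all such sequences. Then the probability that $x_j$ is selected by the greedy procedure run on the sequence $(x_1,\dots,x_j)$ is at least $1-(j-1)/r$.
   Context: A matroid $\mathcal{M}=(E,\mathcal{I})$ with rank function $r(\cdot)$ is loopless if every singleton is independent. A loopless matroid is uniformly dense if $\frac{|X|}{r(X)}\le \frac{|E|}{r(E)}$ for every non-empty $X\subseteq E$. The greedy procedure on a sequence of elements scans the sequence in order and selects an element if and only if it together with the previously selected elements is independent (equivalently, if it is not in the span of the elements preceding it in the sequence). -}

module Defs where

open import Data.Nat using (ℕ; zero; suc; _<_; _≤_; _*_; _⊔_)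
open import Data.Bool using (Bool; true; false; if_then_else_)
open import Data.Fin using (Fin)
open import Data.Fin.Subset using (Subset; ⊥; ⊤; ⁅_⁆; _∪_; _⊆_; _∈_; _∉_; ∣_∣; Nonempty; inside; outside)
open import Data.Fin.Subset.Properties using (_⊆?_)
open import Data.Vec using (Vec; []; _∷_; toList)
open import Data.List using (List; []; _∷_; [_]; map; _++_; concatMap; filter; foldr; allFin; length)
open import Data.Product using (Σ; ∃; _×_; _,_; proj₁; proj₂)
open import Relation.Nullary using (Dec; does; ¬_)
open import Relation.Nullary.Decidable using (_×-dec_)
open import Data.Fin using (_≟_)
import Data.List.Relation.Unary.Unique.DecPropositional as UniqueDec

-- A matroid on the ground set E = Fin n, given by its independent sets
-- (axioms (I1)-(I3)); independence is required to be decidable so that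
-- the greedy procedure and the rank function are computable.
record Matroid (n : ℕ) : Set₁ where
  field
    Indep     : Subset n → Set
    Indep?    : (X : Subset n) → Dec (Indep X)
    indep-∅   : Indep ⊥
    indep-⊆   : ∀ {X Y} → Y ⊆ X → Indep X → Indep Y
    exchange  : ∀ {X Y} → Indep X → Indep Y → ∣ X ∣ < ∣ Y ∣ →
                ∃ λ i → i ∈ Y × i ∉ X × Indep (⁅ i ⁆ ∪ X)

open Matroid public

allSubsets : (n : ℕ) → List (Subset n)
allSubsets zero    = [ [] ]
allSubsets (suc n) = map (outside ∷_) (allSubsets n) ++ map (inside ∷_) (allSubsets n)

rank : ∀ {n} → Matroid n → Subset n → ℕ
rank {n} M X =
  foldr _⊔_ 0 (map ∣_∣ (filter (λ Y → (Y ⊆? X) ×-dec Indep? M Y) (allSubsets n)))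

Loopless : ∀ {n} → Matroid n → Set
Loopless {n} M = (i : Fin n) → Indep M ⁅ i ⁆

-- Uniformly dense: loopless and |X| / r(X) ≤ |E| / r(E) for all non-empty X,
-- written cross-multiplied (both ranks are positive for a loopless matroid
-- and non-empty X).
UniformlyDense : ∀ {n} → Matroid n → Set
UniformlyDense {n} M =
  Loopless M × ((X : Subset n) → Nonempty X → ∣ X ∣ * rank M ⊤ ≤ n * rank M X)

-- Returns the set of
-- selected elements and whether the last scanned element was selected.
greedyScan : ∀ {n} → Matroid n → Subset n → Bool → List (Fin n) → Subset n × Bool
greedyScan M S b []       = S , b
greedyScan M S b (x ∷ xs) =
  let sel = does (Indep? M (⁅ x ⁆ ∪ S))
  in greedyScan M (if sel then ⁅ x ⁆ ∪ S else S) sel xs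

lastSelected : ∀ {n j} → Matroid n → Vec (Fin n) j → Bool
lastSelected M v = proj₂ (greedyScan M ⊥ false (toList v))

allSeqs : (n j : ℕ) → List (Vec (Fin n) j)
allSeqs n zero    = [ [] ]
allSeqs n (suc j) = concatMap (λ x → map (x ∷_) (allSeqs n j)) (allFin n)

distinctSeqs : (n j : ℕ) → List (Vec (Fin n) j)
distinctSeqs n j = filter (λ v → UniqueDec.unique? _≟_ (toList v)) (allSeqs n j)

goodSeqs : ∀ {n} → Matroid n → (j : ℕ) → List (Vec (Fin n) j)
goodSeqs {n} M j = filter (λ v → Data.Bool._≟_ (lastSelected M v) true) (distinctSeqs n j)
  where import Data.Bool

module Submission where

-- Write j = k + 1 and r = r(E), and group the sequences of
-- length k + 1 by their prefix q of length k.  A prefix with a repeated entry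
-- contributes to neither count.  For a prefix q of distinct elements let G be
-- the set selected by the greedy procedure on q and let
--   cl(G) = G ∪ { x | G + x is dependent }.
-- Every entry of q lies in cl(G), so every x ∉ cl(G) extends q to a sequence
-- of distinct elements whose last element is selected.  G is independent with
-- |G| ≤ k, so the exchange axiom gives r(cl G) ≤ k, and uniform density then
-- gives |cl G| · r ≤ n · k.  Hence of the at most n extensions of q at least
-- n - |cl G| ≥ n (r - k) / r are good: (r - k) · #ext(q) ≤ #good(q) · r.
-- Summing over all prefixes proves the bound in ℕ when k ≤ r, which is the
-- cross-multiplied integer statement; when k > r its left side is ≤ 0.

open import Defs
open import Data.Nat using (ℕ; _≤_; _∸_)
open import Data.Fin.Subset using (⊤)
open import Data.List using (length)
open import Data.Integer using (ℤ; +_; _-_; _*_) renaming (_≤_ to _≤ℤ_)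

open import Data.Nat using (zero; suc; z≤n; s≤s; _+_; _⊔_) renaming (_*_ to _·_)
open import Data.Nat.Properties
  using (≤-trans; ≤-reflexive; ≤-total; ≮⇒≥; n≤1+n; m≤m+n; m≤n+m; +-suc; +-assoc;
         +-identityʳ; +-comm; +-mono-≤; +-monoˡ-≤; +-monoʳ-≤; +-cancelʳ-≤; *-comm; *-zeroʳ;
         *-distribˡ-+; *-distribʳ-+; *-monoˡ-≤; *-monoʳ-≤; m∸n+n≡m; ⊔-lub; module ≤-Reasoning)
import Data.Integer as ℤ
import Data.Integer.Properties as ℤ
open import Data.Bool using (Bool; true; false; _∧_; _∨_; not)
open import Data.Bool.Properties using (not-injective)
import Data.Bool as Bool
open import Data.Fin using (Fin; _≟_)
import Data.Fin as Fin
open import Data.Fin.Subset using (Subset; ⊥; ⁅_⁆; _∪_; _⊆_; _∈_; _∉_; ∣_∣)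
open import Data.Fin.Subset.Properties
  using (_∈?_; _⊆?_; nonempty?; Empty-unique; ∣⊥∣≡0; ∣⁅x⁆∣≡1; p⊆p∪q; q⊆p∪q; x∈p∪q⁺; x∈p∪q⁻; x∈⁅x⁆)
open import Data.Vec using (Vec; []; _∷_; toList; _∷ʳ_)
import Data.Vec as Vec
open import Data.Vec.Properties using (toList-∷ʳ; length-toList; lookup∘tabulate; []=⇒lookup)
open import Data.List using (List; []; _∷_; [_]; map; _++_; concatMap; filter; foldr; allFin)
open import Data.List.Properties using (map-tabulate; length-tabulate)
open import Data.List.Membership.Propositional renaming (_∈_ to _∈ₗ_; _∉_ to _∉ₗ_)
open import Data.List.Relation.Unary.Any using (here; there)
open import Data.List.Relation.Unary.Unique.Propositional using (Unique)
import Data.List.Relation.Unary.Unique.Propositional.Properties as Unique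
import Data.List.Relation.Unary.All as All
import Data.List.Relation.Unary.All.Properties as All
import Data.List.Relation.Unary.AllPairs as AllPairs
import Data.List.Relation.Unary.Unique.DecPropositional as UniqueDec
open import Data.Product using (_×_; _,_; proj₁; proj₂)
open import Data.Empty using () renaming (⊥ to Empty)
open import Data.Sum using (_⊎_; inj₁; inj₂)
import Data.Sum as Sum
open import Relation.Nullary using (Dec; does; yes; no; ¬_)
open import Relation.Nullary.Decidable using (dec-true; dec-false; _×-dec_)
open import Relation.Binary.PropositionalEquality using (_≡_; refl; sym; trans; cong; cong₂; subst; subst₂; module ≡-Reasoning)

private
  variable
    A B : Set

-- Sums and counts over lists

bit : Bool → ℕ
bit true  = 1
bit false = 0

sumBy : (A → ℕ) → List A → ℕ
sumBy f []       = 0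
sumBy f (x ∷ xs) = f x + sumBy f xs

countBy : (A → Bool) → List A → ℕ
countBy p = sumBy (λ x → bit (p x))

sumBy-cong : {f g : A → ℕ} (xs : List A) → (∀ x → f x ≡ g x) → sumBy f xs ≡ sumBy g xs
sumBy-cong []       f≗g = refl
sumBy-cong (x ∷ xs) f≗g = cong₂ _+_ (f≗g x) (sumBy-cong xs f≗g)

sumBy-++ : (f : A → ℕ) (xs ys : List A) → sumBy f (xs ++ ys) ≡ sumBy f xs + sumBy f ys
sumBy-++ f []       ys = refl
sumBy-++ f (x ∷ xs) ys = trans (cong (_+_ (f x)) (sumBy-++ f xs ys)) (sym (+-assoc (f x) _ _))

sumBy-map : (f : B → ℕ) (h : A → B) (xs : List A) →
            sumBy f (map h xs) ≡ sumBy (λ x → f (h x)) xs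
sumBy-map f h []       = refl
sumBy-map f h (x ∷ xs) = cong (_+_ (f (h x))) (sumBy-map f h xs)

sumBy-concatMap : (f : B → ℕ) (g : A → List B) (xs : List A) →
                  sumBy f (concatMap g xs) ≡ sumBy (λ x → sumBy f (g x)) xs
sumBy-concatMap f g []       = refl
sumBy-concatMap f g (x ∷ xs) =
  trans (sumBy-++ f (g x) (concatMap g xs)) (cong (_+_ (sumBy f (g x))) (sumBy-concatMap f g xs))

sumBy-cross : (a b : ℕ) (T G : A → ℕ) (xs : List A) →
              (∀ x → a · T x ≤ G x · b) → a · sumBy T xs ≤ sumBy G xs · b
sumBy-cross a b T G []       _ rewrite *-zeroʳ a = z≤n
sumBy-cross a b T G (x ∷ xs) termwise
  rewrite *-distribˡ-+ a (T x) (sumBy T xs) | *-distribʳ-+ b (G x) (sumBy G xs)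
  = +-mono-≤ (termwise x) (sumBy-cross a b T G xs termwise)

countBy-≤-length : (p : A → Bool) (xs : List A) → countBy p xs ≤ length xs
countBy-≤-length p []       = z≤n
countBy-≤-length p (x ∷ xs) with p x
... | true  = s≤s (countBy-≤-length p xs)
... | false = ≤-trans (countBy-≤-length p xs) (n≤1+n _)

countBy-false : (p : A → Bool) (xs : List A) → (∀ x → p x ≡ false) → countBy p xs ≡ 0
countBy-false p []       _       = refl
countBy-false p (x ∷ xs) p≡false rewrite p≡false x = countBy-false p xs p≡false

countBy-mono : {p q : A → Bool} (xs : List A) → (∀ x → p x ≡ true → q x ≡ true) →
               countBy p xs ≤ countBy q xs
countBy-mono               []       _   = z≤n
countBy-mono {p = p} {q} (x ∷ xs) p⇒q with p x in px
... | false = ≤-trans (countBy-mono xs p⇒q) (m≤n+m _ (bit (q x)))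
... | true rewrite p⇒q x px = s≤s (countBy-mono xs p⇒q)

countBy-complement : (p : A → Bool) (xs : List A) →
                     countBy p xs + countBy (λ x → not (p x)) xs ≡ length xs
countBy-complement p []       = refl
countBy-complement p (x ∷ xs) with p x
... | true  = cong suc (countBy-complement p xs)
... | false = trans (+-suc _ _) (cong suc (countBy-complement p xs))

length-filter : {P : A → Set} (P? : ∀ x → Dec (P x)) (xs : List A) →
                length (filter P? xs) ≡ countBy (λ x → does (P? x)) xs
length-filter P? []       = refl
length-filter P? (x ∷ xs) with does (P? x)
... | true  = cong suc (length-filter P? xs)
... | false = length-filter P? xs

countBy-filter : {P : A → Set} (P? : ∀ x → Dec (P x)) (q : A → Bool) (xs : List A) →
                 countBy q (filter P? xs) ≡ countBy (λ x → does (P? x) ∧ q x) xs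
countBy-filter P? q []       = refl
countBy-filter P? q (x ∷ xs) with does (P? x)
... | true  = cong (_+_ (bit (q x))) (countBy-filter P? q xs)
... | false = countBy-filter P? q xs

sumBy-allSeqs-∷ʳ : ∀ n k (f : Vec (Fin n) (suc k) → ℕ) →
  sumBy f (allSeqs n (suc k)) ≡ sumBy (λ q → sumBy (λ x → f (q ∷ʳ x)) (allFin n)) (allSeqs n k)
sumBy-allSeqs-∷ʳ n zero f = begin
  sumBy f (concatMap (λ x → map (x ∷_) [ [] ]) (allFin n))
    ≡⟨ sumBy-concatMap f _ (allFin n) ⟩
  sumBy (λ x → f (x ∷ []) + 0) (allFin n)
    ≡⟨ sumBy-cong (allFin n) (λ x → +-identityʳ _) ⟩
  sumBy (λ x → f (x ∷ [])) (allFin n)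
    ≡⟨ sym (+-identityʳ _) ⟩
  sumBy (λ q → sumBy (λ x → f (q ∷ʳ x)) (allFin n)) [ [] ] ∎
  where open ≡-Reasoning
sumBy-allSeqs-∷ʳ n (suc k) f = begin
  sumBy f (concatMap (λ y → map (y ∷_) (allSeqs n (suc k))) (allFin n))
    ≡⟨ sumBy-concatMap f _ (allFin n) ⟩
  sumBy (λ y → sumBy f (map (y ∷_) (allSeqs n (suc k)))) (allFin n)
    ≡⟨ sumBy-cong (allFin n) (λ y → trans (sumBy-map f (y ∷_) (allSeqs n (suc k)))
                                          (sumBy-allSeqs-∷ʳ n k (λ v → f (y ∷ v)))) ⟩
  sumBy (λ y → sumBy (λ q → extend (y ∷ q)) (allSeqs n k)) (allFin n)
    ≡⟨ sumBy-cong (allFin n) (λ y → sym (sumBy-map extend (y ∷_) (allSeqs n k))) ⟩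
  sumBy (λ y → sumBy extend (map (y ∷_) (allSeqs n k))) (allFin n)
    ≡⟨ sym (sumBy-concatMap extend _ (allFin n)) ⟩
  sumBy extend (allSeqs n (suc k)) ∎
  where
  open ≡-Reasoning
  extend : Vec (Fin n) (suc k) → ℕ
  extend q = sumBy (λ x → f (q ∷ʳ x)) (allFin n)

∣b∷p∣ : ∀ {n} b (p : Subset n) → ∣ b ∷ p ∣ ≡ bit b + ∣ p ∣
∣b∷p∣ true  p = refl
∣b∷p∣ false p = refl

∣tabulate∣ : ∀ {n} (f : Fin n → Bool) → ∣ Vec.tabulate f ∣ ≡ countBy f (allFin n)
∣tabulate∣ {zero}  f = refl
∣tabulate∣ {suc n} f = begin
  ∣ f Fin.zero ∷ Vec.tabulate (λ i → f (Fin.suc i)) ∣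
    ≡⟨ ∣b∷p∣ (f Fin.zero) (Vec.tabulate (λ i → f (Fin.suc i))) ⟩
  bit (f Fin.zero) + ∣ Vec.tabulate (λ i → f (Fin.suc i)) ∣
    ≡⟨ cong (_+_ (bit (f Fin.zero))) (∣tabulate∣ (λ i → f (Fin.suc i))) ⟩
  bit (f Fin.zero) + countBy (λ i → f (Fin.suc i)) (allFin n)
    ≡⟨ cong (_+_ (bit (f Fin.zero))) (sym (sumBy-map (λ i → bit (f i)) Fin.suc (allFin n))) ⟩
  bit (f Fin.zero) + countBy f (map Fin.suc (allFin n))
    ≡⟨ cong (λ xs → bit (f Fin.zero) + countBy f xs) (map-tabulate (λ i → i) Fin.suc) ⟩
  countBy f (allFin (suc n)) ∎
  where open ≡-Reasoning

∈-tabulate : ∀ {n} (f : Fin n → Bool) {x : Fin n} → x ∈ Vec.tabulate f → f x ≡ true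
∈-tabulate f {x} x∈ = trans (sym (lookup∘tabulate f x)) ([]=⇒lookup x∈)

∣p∪q∣≤∣p∣+∣q∣ : ∀ {n} (p q : Subset n) → ∣ p ∪ q ∣ ≤ ∣ p ∣ + ∣ q ∣
∣p∪q∣≤∣p∣+∣q∣ []          []          = z≤n
∣p∪q∣≤∣p∣+∣q∣ (true ∷ p)  (true ∷ q)  = s≤s (≤-trans (∣p∪q∣≤∣p∣+∣q∣ p q) (+-monoʳ-≤ ∣ p ∣ (n≤1+n _)))
∣p∪q∣≤∣p∣+∣q∣ (true ∷ p)  (false ∷ q) = s≤s (∣p∪q∣≤∣p∣+∣q∣ p q)
∣p∪q∣≤∣p∣+∣q∣ (false ∷ p) (true ∷ q)  = ≤-trans (s≤s (∣p∪q∣≤∣p∣+∣q∣ p q)) (≤-reflexive (sym (+-suc _ _)))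
∣p∪q∣≤∣p∣+∣q∣ (false ∷ p) (false ∷ q) = ∣p∪q∣≤∣p∣+∣q∣ p q

Unique-++⁻ˡ : (xs ys : List A) → Unique (xs ++ ys) → Unique xs
Unique-++⁻ˡ []       ys _                = AllPairs.[]
Unique-++⁻ˡ (x ∷ xs) ys (x∉ AllPairs.∷ u) = All.++⁻ˡ xs x∉ AllPairs.∷ Unique-++⁻ˡ xs ys u

Unique-∷ʳ⁺ : {xs : List A} {x : A} → Unique xs → x ∉ₗ xs → Unique (xs ++ [ x ])
Unique-∷ʳ⁺ u x∉xs = Unique.++⁺ u (All.[] AllPairs.∷ AllPairs.[]) λ where (v∈xs , here refl) → x∉xs v∈xs

rank-≤ : ∀ {n} (M : Matroid n) (X : Subset n) (g : ℕ) →
         (∀ Y → Y ⊆ X → Indep M Y → ∣ Y ∣ ≤ g) → rank M X ≤ g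
rank-≤ {n} M X g bound = foldr-bound (allSubsets n)
  where
  foldr-bound : ∀ Ys → foldr _⊔_ 0 (map ∣_∣ (filter (λ Y → (Y ⊆? X) ×-dec Indep? M Y) Ys)) ≤ g
  foldr-bound []       = z≤n
  foldr-bound (Y ∷ Ys) with Y ⊆? X | Indep? M Y
  ... | yes Y⊆X | yes indY = ⊔-lub (bound Y Y⊆X indY) (foldr-bound Ys)
  ... | yes _   | no _     = foldr-bound Ys
  ... | no _    | _        = foldr-bound Ys

dense-bound : ∀ {n} (M : Matroid n) → UniformlyDense M →
              (X : Subset n) (k : ℕ) → rank M X ≤ k → ∣ X ∣ · rank M ⊤ ≤ n · k
dense-bound {n} M (_ , dense) X k rX≤k with nonempty? X
... | yes ne  = ≤-trans (dense X ne) (*-monoʳ-≤ n rX≤k)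
... | no ¬ne rewrite Empty-unique ¬ne | ∣⊥∣≡0 n = z≤n

-- The greedy procedure

module Greedy {n : ℕ} (M : Matroid n) where

  scanned : Subset n → Bool → List (Fin n) → Subset n
  scanned S b xs = proj₁ (greedyScan M S b xs)

  scan-++ : ∀ S b (xs ys : List (Fin n)) →
            greedyScan M S b (xs ++ ys) ≡ greedyScan M (scanned S b xs) (proj₂ (greedyScan M S b xs)) ys
  scan-++ S b []       ys = refl
  scan-++ S b (x ∷ xs) ys = scan-++ _ _ xs ys

  scan-indep : ∀ S b xs → Indep M S → Indep M (scanned S b xs)
  scan-indep S b []       indS = indS
  scan-indep S b (x ∷ xs) indS with Indep? M (⁅ x ⁆ ∪ S)
  ... | yes indS′ = scan-indep _ true xs indS′
  ... | no _      = scan-indep S false xs indS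

  scan-⊆ : ∀ S b xs → S ⊆ scanned S b xs
  scan-⊆ S b []       = λ x∈S → x∈S
  scan-⊆ S b (x ∷ xs) with Indep? M (⁅ x ⁆ ∪ S)
  ... | yes _ = λ y∈S → scan-⊆ _ true xs (q⊆p∪q ⁅ x ⁆ S y∈S)
  ... | no _  = scan-⊆ S false xs

  scan-card : ∀ S b xs → ∣ scanned S b xs ∣ ≤ ∣ S ∣ + length xs
  scan-card S b []       = m≤m+n _ _
  scan-card S b (x ∷ xs) with Indep? M (⁅ x ⁆ ∪ S)
  ... | no _  = ≤-trans (scan-card S false xs) (+-monoʳ-≤ ∣ S ∣ (n≤1+n _))
  ... | yes _ = begin
    ∣ scanned (⁅ x ⁆ ∪ S) true xs ∣  ≤⟨ scan-card _ true xs ⟩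
    ∣ ⁅ x ⁆ ∪ S ∣ + length xs         ≤⟨ +-monoˡ-≤ (length xs) (∣p∪q∣≤∣p∣+∣q∣ ⁅ x ⁆ S) ⟩
    ∣ ⁅ x ⁆ ∣ + ∣ S ∣ + length xs     ≡⟨ cong (λ c → c + ∣ S ∣ + length xs) (∣⁅x⁆∣≡1 x) ⟩
    suc (∣ S ∣ + length xs)           ≡⟨ sym (+-suc ∣ S ∣ (length xs)) ⟩
    ∣ S ∣ + suc (length xs)           ∎
    where open ≤-Reasoning

  scan-spans : ∀ S b xs {y} → y ∈ₗ xs → y ∈ scanned S b xs ⊎ ¬ Indep M (⁅ y ⁆ ∪ scanned S b xs)
  scan-spans S b (x ∷ xs) (there y∈xs) with Indep? M (⁅ x ⁆ ∪ S)
  ... | yes _ = scan-spans _ true xs y∈xs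
  ... | no _  = scan-spans S false xs y∈xs
  scan-spans S b (x ∷ xs) (here refl) with Indep? M (⁅ x ⁆ ∪ S)
  ... | yes _    = inj₁ (scan-⊆ _ true xs (p⊆p∪q S (x∈⁅x⁆ x)))
  ... | no ¬indS′ = inj₂ λ ind → ¬indS′ (indep-⊆ M ∪-mono ind)
    where
    ∪-mono : ⁅ x ⁆ ∪ S ⊆ ⁅ x ⁆ ∪ scanned S false xs
    ∪-mono z∈ = x∈p∪q⁺ (Sum.map₂ (scan-⊆ S false xs) (x∈p∪q⁻ ⁅ x ⁆ S z∈))

  greedySet : List (Fin n) → Subset n
  greedySet = scanned ⊥ false

  greedySet-indep : ∀ xs → Indep M (greedySet xs)
  greedySet-indep xs = scan-indep ⊥ false xs (indep-∅ M)

  greedySet-card : ∀ {k} (q : Vec (Fin n) k) → ∣ greedySet (toList q) ∣ ≤ k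
  greedySet-card q =
    ≤-trans (scan-card ⊥ false (toList q)) (≤-reflexive (cong₂ _+_ (∣⊥∣≡0 n) (length-toList q)))

  lastSelected-∷ʳ : ∀ {k} (q : Vec (Fin n) k) x →
                    lastSelected M (q ∷ʳ x) ≡ does (Indep? M (⁅ x ⁆ ∪ greedySet (toList q)))
  lastSelected-∷ʳ q x =
    cong proj₂ (trans (cong (greedyScan M ⊥ false) (toList-∷ʳ x q)) (scan-++ ⊥ false (toList q) [ x ]))

  inClosure : Subset n → Fin n → Bool
  inClosure G x = does (x ∈? G) ∨ not (does (Indep? M (⁅ x ⁆ ∪ G)))

  closure : Subset n → Subset n
  closure G = Vec.tabulate (inClosure G)

  outside-closure⁻ : ∀ G x → inClosure G x ≡ false → x ∉ G × Indep M (⁅ x ⁆ ∪ G)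
  outside-closure⁻ G x out with x ∈? G | Indep? M (⁅ x ⁆ ∪ G)
  outside-closure⁻ G x () | yes _ | _
  outside-closure⁻ G x () | no _  | no _
  ... | no x∉G | yes ind = x∉G , ind

  outside-closure⁺ : ∀ G x → x ∉ G → Indep M (⁅ x ⁆ ∪ G) → inClosure G x ≡ false
  outside-closure⁺ G x x∉G ind rewrite dec-false (x ∈? G) x∉G | dec-true (Indep? M (⁅ x ⁆ ∪ G)) ind = refl

  -- An independent set spans its closure: by the exchange axiom a larger
  -- independent subset of cl(G) would contain an element outside cl(G).
  rank-closure : ∀ G → Indep M G → rank M (closure G) ≤ ∣ G ∣
  rank-closure G indG = rank-≤ M (closure G) ∣ G ∣ λ Y Y⊆cl indY → ≮⇒≥ λ ∣G∣<∣Y∣ →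
    let (i , i∈Y , i∉G , indGi) = exchange M indG indY ∣G∣<∣Y∣
        in-cl  = ∈-tabulate (inClosure G) (Y⊆cl i∈Y)
        out-cl = outside-closure⁺ G i i∉G indGi
    in true≢false (trans (sym in-cl) out-cl)
    where
    true≢false : true ≡ false → Empty
    true≢false ()

  closure-partition : ∀ G → ∣ closure G ∣ + countBy (λ x → not (inClosure G x)) (allFin n) ≡ n
  closure-partition G = begin
    ∣ closure G ∣ + countBy (λ x → not (inClosure G x)) (allFin n)
      ≡⟨ cong (λ m → m + countBy (λ x → not (inClosure G x)) (allFin n)) (∣tabulate∣ (inClosure G)) ⟩
    countBy (inClosure G) (allFin n) + countBy (λ x → not (inClosure G x)) (allFin n)
      ≡⟨ countBy-complement (inClosure G) (allFin n) ⟩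
    length (allFin n)
      ≡⟨ length-tabulate (λ i → i) ⟩
    n ∎
    where open ≡-Reasoning

  outside-closure-unscanned : ∀ xs x → inClosure (greedySet xs) x ≡ false → x ∉ₗ xs
  outside-closure-unscanned xs x out x∈xs with scan-spans ⊥ false xs x∈xs | outside-closure⁻ _ x out
  ... | inj₁ x∈G | x∉G , _   = x∉G x∈G
  ... | inj₂ dep | _   , ind = dep ind

-- Arithmetic core: out of T ≤ n extensions, the n = X + c candidates split
-- into X "bad" and c "free" ones with c ≤ G good ones; if X · r ≤ n · k then
-- the good ones are at least a fraction (r - k) / r of all extensions.
fraction-bound : ∀ {r k n T X c G} → k ≤ r → T ≤ n → X + c ≡ n → c ≤ G → X · r ≤ n · k →
                 (r ∸ k) · T ≤ G · r
fraction-bound {r} {k} {n} {T} {X} {c} {G} k≤r T≤n X+c≡n c≤G dense =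
  ≤-trans (*-monoʳ-≤ (r ∸ k) T≤n) (≤-trans (+-cancelʳ-≤ (n · k) _ _ key) (*-monoˡ-≤ r c≤G))
  where
  open ≤-Reasoning
  key : (r ∸ k) · n + n · k ≤ c · r + n · k
  key = begin
    (r ∸ k) · n + n · k  ≡⟨ cong (_+_ ((r ∸ k) · n)) (*-comm n k) ⟩
    (r ∸ k) · n + k · n  ≡⟨ sym (*-distribʳ-+ n (r ∸ k) k) ⟩
    (r ∸ k + k) · n      ≡⟨ cong (_· n) (m∸n+n≡m k≤r) ⟩
    r · n                ≡⟨ *-comm r n ⟩
    n · r                ≡⟨ cong (_· r) (sym X+c≡n) ⟩
    (X + c) · r          ≡⟨ *-distribʳ-+ r X c ⟩
    X · r + c · r        ≤⟨ +-monoˡ-≤ (c · r) dense ⟩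
    n · k + c · r        ≡⟨ +-comm (n · k) (c · r) ⟩
    c · r + n · k        ∎

-- The bound for a single prefix

module Prefix {n : ℕ} (M : Matroid n) where
  open Greedy M

  distinct : ∀ {k} → Vec (Fin n) k → Bool
  distinct v = does (UniqueDec.unique? _≟_ (toList v))

  good : ∀ {k} → Vec (Fin n) k → Bool
  good v = does (lastSelected M v Bool.≟ true)

  extensions : ∀ {k} → Vec (Fin n) k → ℕ
  extensions q = countBy (λ x → distinct (q ∷ʳ x)) (allFin n)

  goodExtensions : ∀ {k} → Vec (Fin n) k → ℕ
  goodExtensions q = countBy (λ x → distinct (q ∷ʳ x) ∧ good (q ∷ʳ x)) (allFin n)

  extensions-repeated : ∀ {k} (q : Vec (Fin n) k) → ¬ Unique (toList q) → extensions q ≡ 0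
  extensions-repeated q repeated = countBy-false _ (allFin n) λ x →
    dec-false (UniqueDec.unique? _≟_ (toList (q ∷ʳ x)))
      λ u → repeated (Unique-++⁻ˡ (toList q) [ x ] (subst Unique (toList-∷ʳ x q) u))

  outside-closure-good : ∀ {k} (q : Vec (Fin n) k) → Unique (toList q) → ∀ x →
                         inClosure (greedySet (toList q)) x ≡ false →
                         distinct (q ∷ʳ x) ∧ good (q ∷ʳ x) ≡ true
  outside-closure-good q u x out = cong₂ _∧_
    (dec-true (UniqueDec.unique? _≟_ (toList (q ∷ʳ x)))
      (subst Unique (sym (toList-∷ʳ x q)) (Unique-∷ʳ⁺ u (outside-closure-unscanned (toList q) x out))))
    (dec-true (lastSelected M (q ∷ʳ x) Bool.≟ true)
      (trans (lastSelected-∷ʳ q x) (dec-true (Indep? M _) (proj₂ (outside-closure⁻ _ x out)))))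

  prefix-bound : UniformlyDense M → ∀ {k} → k ≤ rank M ⊤ → (q : Vec (Fin n) k) →
                 (rank M ⊤ ∸ k) · extensions q ≤ goodExtensions q · rank M ⊤
  prefix-bound ud {k} k≤r q with UniqueDec.unique? _≟_ (toList q)
  ... | no repeated rewrite extensions-repeated q repeated | *-zeroʳ (rank M ⊤ ∸ k) = z≤n
  ... | yes u = fraction-bound k≤r
      (≤-trans (countBy-≤-length _ (allFin n)) (≤-reflexive (length-tabulate (λ i → i))))
      (closure-partition G)
      (countBy-mono (allFin n) λ x free → outside-closure-good q u x (not-injective free))
      (dense-bound M ud (closure G) k
        (≤-trans (rank-closure G (greedySet-indep (toList q))) (greedySet-card q)))
    where
    G : Subset n
    G = greedySet (toList q)

  sequences-bound : UniformlyDense M → ∀ k → k ≤ rank M ⊤ →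
                    (rank M ⊤ ∸ k) · length (distinctSeqs n (suc k))
                      ≤ length (goodSeqs M (suc k)) · rank M ⊤
  sequences-bound ud k k≤r =
    subst₂ (λ D G → (rank M ⊤ ∸ k) · D ≤ G · rank M ⊤) (sym #distinct) (sym #good)
      (sumBy-cross (rank M ⊤ ∸ k) (rank M ⊤) extensions goodExtensions (allSeqs n k) (prefix-bound ud k≤r))
    where
    #distinct : length (distinctSeqs n (suc k)) ≡ sumBy extensions (allSeqs n k)
    #distinct = trans (length-filter _ (allSeqs n (suc k))) (sumBy-allSeqs-∷ʳ n k _)
    #good : length (goodSeqs M (suc k)) ≡ sumBy goodExtensions (allSeqs n k)
    #good = trans (length-filter _ (distinctSeqs n (suc k)))
                  (trans (countBy-filter _ _ (allSeqs n (suc k))) (sumBy-allSeqs-∷ʳ n k _))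

-- A cross-multiplied bound with truncated subtraction gives the integer bound:
-- if k ≤ r it is the same statement, and otherwise r - k < 0.
integer-bound : ∀ r k T G → (k ≤ r → (r ∸ k) · T ≤ G · r) → (+ r - + k) * + T ≤ℤ + G * + r
integer-bound r k T G bound with ≤-total k r
... | inj₁ k≤r
  rewrite ℤ.m-n≡m⊖n r k | ℤ.⊖-≥ k≤r | sym (ℤ.pos-* (r ∸ k) T) | sym (ℤ.pos-* G r)
  = ℤ.+≤+ (bound k≤r)
... | inj₂ r≤k = ℤ.≤-trans (ℤ.*-monoʳ-≤-nonNeg (+ T) (ℤ.i≤j⇒i-j≤0 (ℤ.+≤+ r≤k)))
                           (subst (ℤ.0ℤ ≤ℤ_) (ℤ.pos-* G r) (ℤ.+≤+ z≤n))

lemma1 : (n : ℕ) (M : Matroid n) → UniformlyDense M →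
         (j : ℕ) → 1 ≤ j → j ≤ n →
         (+ rank M ⊤ - + (j ∸ 1)) * + length (distinctSeqs n j)
           ≤ℤ + length (goodSeqs M j) * + rank M ⊤
lemma1 n M ud (suc k) _ _ =
  integer-bound (rank M ⊤) k (length (distinctSeqs n (suc k))) (length (goodSeqs M (suc k)))
    (Prefix.sequences-bound M ud k)
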